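{- Let $\delta$ be a new atomic formula symbol. The logic $\mathsf{QLP}^-(\delta\leftrightarrow\neg(\exists x)x:\delta)_{\emptyset}$, i.e. $\mathsf{QLP}^-$ without the Axiom Necessitation rule, over the language extended by $\delta$, with the single additional axiom $\delta\leftrightarrow\neg(\exists x)x:\delta$, is consistent.
   Context: Fix countably many justification variables, propositional variables, and primitive function symbols of each arity $n\ge0$; a primitive term is $f(x_1,\dots,x_n)$ with $x_i$ variables. Terms of $\mathsf{QLP}^-$: $t::= x\mid f(x_1,\dots,x_n)\mid t\cdot t\mid t+t\mid !t$. Formulas: $A::= p\mid\bot\mid\neg A\mid A\wedge A\mid A\vee A\mid A\rightarrow A\mid t:A\mid(\forall x)A\mid(\exists x)A$, quantifiers over justification variables. Axioms: all propositional tautologies; Q1: $(\forall x)A(x)\rightarrow A(t)$, $t$ free for $x$; Q2: $(\forall x)(A\rightarrow B(x))\rightarrow(A\rightarrow(\forall x)B(x))$, $x$ not free in $A$; Q3: $A(t)\rightarrow(\exists x)A(x)$, $t$ free for $x$; Q4: $(\forall x)(A(x)\rightarrow B)\rightarrow((\exists x)A(x)\rightarrow B)$, $x$ not free in $B$; jK: $s:(A\rightarrow B)\rightarrow(t:A\rightarrow(s\cdot t):B)$; jT: $t:A\rightarrow A$; j4: $t:A\rightarrow !t:t:A$; Sum: $s:A\rightarrow(s+t):A$, $s:A\rightarrow(t+s):A$. Rules: Modus Ponens; Gen: from $A$ infer $(\forall x)A$; Axiom Necessitation: from an axiom instance $A$ infer $f(x_1,\dots,x_n):A$. The subscript $\emptyset$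 means Axiom Necessitation is dropped. All schemes and rules apply to formulas of the extended language. -}

module Defs where

open import Data.Nat using (ℕ; _≡ᵇ_)
open import Data.Bool using (Bool; true; false; not; _∧_; _∨_; if_then_else_)
open import Data.Vec using (Vec)
import Data.Vec as V
open import Data.Maybe using (Maybe; just; nothing; map; _>>=_)
open import Data.Product using (_×_; _,_)
open import Relation.Binary.PropositionalEquality using (_≡_)
open import Relation.Nullary using (¬_)

infixl 7 _·_
infixl 6 _⊕_
infix  8 !_

data Term : Set where
  var  : ℕ → Term
  fun  : (n : ℕ) → ℕ → Vec ℕ n → Term       -- primitive term f^n_i(x_{k1},…,x_{kn})
  _·_  : Term → Term → Term
  _⊕_  : Term → Term → Term
  !_   : Term → Term

infixr 3 _⇒_
infixr 4 _∨'_
infixr 5 _∧'_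
infix  6 _∶_
infix  7 ¬'_
infix  2 _⇔_

data Formula : Set where
  prop : ℕ → Formula
  δ    : Formula
  ⊥'   : Formula
  ¬'_  : Formula → Formula
  _∧'_ : Formula → Formula → Formula
  _∨'_ : Formula → Formula → Formula
  _⇒_  : Formula → Formula → Formula
  _∶_  : Term → Formula → Formula
  ∀'   : ℕ → Formula → Formula
  ∃'   : ℕ → Formula → Formula

_⇔_ : Formula → Formula → Formula
A ⇔ B = (A ⇒ B) ∧' (B ⇒ A)

eval : (Formula → Bool) → Formula → Bool
eval v (prop p)  = v (prop p)
eval v δ         = v δ
eval v ⊥'        = false
eval v (¬' A)    = not (eval v A)
eval v (A ∧' B)  = eval v A ∧ eval v B
eval v (A ∨' B)  = eval v A ∨ eval v B
eval v (A ⇒ B)   = not (eval v A) ∨ eval v B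
eval v (t ∶ A)   = v (t ∶ A)
eval v (∀' x A)  = v (∀' x A)
eval v (∃' x A)  = v (∃' x A)

Tautology : Formula → Set
Tautology A = (v : Formula → Bool) → eval v A ≡ true

anyV : ∀ {n} → (ℕ → Bool) → Vec ℕ n → Bool
anyV p V.[]       = false
anyV p (y V.∷ ys) = p y ∨ anyV p ys

occT : ℕ → Term → Bool
occT x (var y)      = x ≡ᵇ y
occT x (fun n i ys) = anyV (x ≡ᵇ_) ys
occT x (s · t)      = occT x s ∨ occT x t
occT x (s ⊕ t)      = occT x s ∨ occT x t
occT x (! t)        = occT x t

freeF : ℕ → Formula → Bool
freeF x (prop p)  = false
freeF x δ         = false
freeF x ⊥'        = false
freeF x (¬' A)    = freeF x A
freeF x (A ∧' B)  = freeF x A ∨ freeF x B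
freeF x (A ∨' B)  = freeF x A ∨ freeF x B
freeF x (A ⇒ B)   = freeF x A ∨ freeF x B
freeF x (t ∶ A)   = occT x t ∨ freeF x A
freeF x (∀' y A)  = not (x ≡ᵇ y) ∧ freeF x A
freeF x (∃' y A)  = not (x ≡ᵇ y) ∧ freeF x A

freeFor : Term → ℕ → Formula → Bool
freeFor t x (prop p)  = true
freeFor t x δ         = true
freeFor t x ⊥'        = true
freeFor t x (¬' A)    = freeFor t x A
freeFor t x (A ∧' B)  = freeFor t x A ∧ freeFor t x B
freeFor t x (A ∨' B)  = freeFor t x A ∧ freeFor t x B
freeFor t x (A ⇒ B)   = freeFor t x A ∧ freeFor t x B
freeFor t x (s ∶ A)   = freeFor t x A
freeFor t x (∀' y A)  = not (freeF x (∀' y A)) ∨ (not (occT y t) ∧ freeFor t x A)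
freeFor t x (∃' y A)  = not (freeF x (∃' y A)) ∨ (not (occT y t) ∧ freeFor t x A)

-- Since arguments of primitive terms must be variables, substituting a
-- non-variable term for an argument of a primitive term does not yield a
-- well-formed term; in that case the result is `nothing` (no instance).

renV : ∀ {n} → ℕ → ℕ → Vec ℕ n → Vec ℕ n
renV x y = V.map (λ z → if x ≡ᵇ z then y else z)

substT : ℕ → Term → Term → Maybe Term
substT x t (var y) = if x ≡ᵇ y then just t else just (var y)
substT x t (fun n i ys) with anyV (x ≡ᵇ_) ys | t
... | false | _     = just (fun n i ys)
... | true  | var y = just (fun n i (renV x y ys))
... | true  | _     = nothing
substT x t (s · u) = substT x t s >>= λ s' → map (s' ·_) (substT x t u)
substT x t (s ⊕ u) = substT x t s >>= λ s' → map (s' ⊕_) (substT x t u)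
substT x t (! s)   = map !_ (substT x t s)

subst : ℕ → Term → Formula → Maybe Formula
subst x t (prop p)  = just (prop p)
subst x t δ         = just δ
subst x t ⊥'        = just ⊥'
subst x t (¬' A)    = map ¬'_ (subst x t A)
subst x t (A ∧' B)  = subst x t A >>= λ A' → map (A' ∧'_) (subst x t B)
subst x t (A ∨' B)  = subst x t A >>= λ A' → map (A' ∨'_) (subst x t B)
subst x t (A ⇒ B)   = subst x t A >>= λ A' → map (A' ⇒_) (subst x t B)
subst x t (s ∶ A)   = substT x t s >>= λ s' → map (s' ∶_) (subst x t A)
subst x t (∀' y A)  = if x ≡ᵇ y then just (∀' y A) else map (∀' y) (subst x t A)
subst x t (∃' y A)  = if x ≡ᵇ y then just (∃' y A) else map (∃' y) (subst x t A)

δ-axiom : Formula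
δ-axiom = δ ⇔ ¬' (∃' 0 (var 0 ∶ δ))

data ⊢_ : Formula → Set where
  taut : ∀ {A} → Tautology A → ⊢ A
  Q1   : ∀ {x t A B} → freeFor t x A ≡ true → subst x t A ≡ just B →
         ⊢ (∀' x A ⇒ B)
  Q2   : ∀ {x A B} → freeF x A ≡ false →
         ⊢ (∀' x (A ⇒ B) ⇒ (A ⇒ ∀' x B))
  Q3   : ∀ {x t A B} → freeFor t x A ≡ true → subst x t A ≡ just B →
         ⊢ (B ⇒ ∃' x A)
  Q4   : ∀ {x A B} → freeF x B ≡ false →
         ⊢ (∀' x (A ⇒ B) ⇒ (∃' x A ⇒ B))
  jK   : ∀ {s t A B} → ⊢ (s ∶ (A ⇒ B) ⇒ (t ∶ A ⇒ (s · t) ∶ B))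
  jT   : ∀ {t A} → ⊢ (t ∶ A ⇒ A)
  j4   : ∀ {t A} → ⊢ (t ∶ A ⇒ (! t) ∶ (t ∶ A))
  sumL : ∀ {s t A} → ⊢ (s ∶ A ⇒ (s ⊕ t) ∶ A)
  sumR : ∀ {s t A} → ⊢ (s ∶ A ⇒ (t ⊕ s) ∶ A)
  ax-δ : ⊢ δ-axiom
  mp   : ∀ {A B} → ⊢ (A ⇒ B) → ⊢ A → ⊢ B
  gen  : ∀ {x A} → ⊢ A → ⊢ ∀' x A

Consistent : Set
Consistent = ¬ (⊢ ⊥')

module Submission where

-- Interpret every formula by the Boolean `value` obtained by erasing
-- quantifiers, making all propositional atoms and δ true, and making every
-- justification assertion t:A false.  Without Axiom Necessitation no rule
-- can force a formula t:A to be provable, so falsifying all of them is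
-- harmless: jK, j4 and Sum have antecedent false, jT becomes false → A,
-- and the extra axiom reads true ↔ ¬false.  Erasing quantifiers makes
-- Q1–Q4 instances of A → A (substitution does not change `value`) and
-- makes Gen trivially sound.

open import Defs
open import Data.Bool using (Bool; true; false; not; _∧_; _∨_)
open import Data.Bool.Properties using (∨-inverseˡ)
open import Data.Maybe using (Maybe; just; map; _>>=_)
open import Data.Nat using (ℕ; _≡ᵇ_)
open import Data.Product using (∃-syntax; _×_; _,_)
open import Relation.Binary.PropositionalEquality
  using (_≡_; refl; sym; trans; cong; cong₂)

value : Formula → Bool
value (prop p)  = true
value δ         = true
value ⊥'        = false
value (¬' A)    = not (value A)
value (A ∧' B)  = value A ∧ value B
value (A ∨' B)  = value A ∨ value B
value (A ⇒ B)   = not (value A) ∨ value B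
value (t ∶ A)   = false
value (∀' x A)  = value A
value (∃' x A)  = value A

eval-value : (A : Formula) → eval value A ≡ value A
eval-value (prop p)  = refl
eval-value δ         = refl
eval-value ⊥'        = refl
eval-value (¬' A)    = cong not (eval-value A)
eval-value (A ∧' B)  = cong₂ _∧_ (eval-value A) (eval-value B)
eval-value (A ∨' B)  = cong₂ _∨_ (eval-value A) (eval-value B)
eval-value (A ⇒ B)   = cong₂ (λ a b → not a ∨ b) (eval-value A) (eval-value B)
eval-value (t ∶ A)   = refl
eval-value (∀' x A)  = refl
eval-value (∃' x A)  = refl

tautology-true : (A : Formula) → Tautology A → value A ≡ true
tautology-true A taut-A = trans (sym (eval-value A)) (taut-A value)

map-just : {A B : Set} {f : A → B} (m : Maybe A) {b : B} →
           map f m ≡ just b → ∃[ a ] (m ≡ just a × f a ≡ b)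
map-just (just a) refl = a , refl , refl

bind-map-just : {A B C : Set} {f : A → B → C} (m : Maybe A) (n : Maybe B) {c : C} →
                (m >>= λ a → map (f a) n) ≡ just c →
                ∃[ a ] ∃[ b ] (m ≡ just a × n ≡ just b × f a b ≡ c)
bind-map-just (just a) (just b) refl = a , b , refl , refl , refl

-- Substitution does not change the value: it only alters terms, which
-- the model never inspects (justification assertions are all false).
value-subst : (x : ℕ) (t : Term) (A : Formula) {B : Formula} →
              subst x t A ≡ just B → value A ≡ value B
value-subst x t (prop p) refl = refl
value-subst x t δ        refl = refl
value-subst x t ⊥'       refl = refl
value-subst x t (¬' A) e with map-just {f = ¬'_} (subst x t A) e
... | A' , eA , refl = cong not (value-subst x t A eA)
value-subst x t (A ∧' C) e with bind-map-just {f = _∧'_} (subst x t A) (subst x t C) e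
... | A' , C' , eA , eC , refl = cong₂ _∧_ (value-subst x t A eA) (value-subst x t C eC)
value-subst x t (A ∨' C) e with bind-map-just {f = _∨'_} (subst x t A) (subst x t C) e
... | A' , C' , eA , eC , refl = cong₂ _∨_ (value-subst x t A eA) (value-subst x t C eC)
value-subst x t (A ⇒ C) e with bind-map-just {f = _⇒_} (subst x t A) (subst x t C) e
... | A' , C' , eA , eC , refl =
  cong₂ (λ a c → not a ∨ c) (value-subst x t A eA) (value-subst x t C eC)
value-subst x t (s ∶ A) e with bind-map-just {f = _∶_} (substT x t s) (subst x t A) e
... | s' , A' , _ , _ , refl = refl
value-subst x t (∀' y A) e with x ≡ᵇ y
value-subst x t (∀' y A) refl | true = refl
value-subst x t (∀' y A) e    | false with map-just {f = ∀' y} (subst x t A) e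
... | A' , eA , refl = value-subst x t A eA
value-subst x t (∃' y A) e with x ≡ᵇ y
value-subst x t (∃' y A) refl | true = refl
value-subst x t (∃' y A) e    | false with map-just {f = ∃' y} (subst x t A) e
... | A' , eA , refl = value-subst x t A eA

equal-implication : (A B : Formula) → value A ≡ value B → value (A ⇒ B) ≡ true
equal-implication A B e = trans (cong (λ b → not (value A) ∨ b) (sym e)) (∨-inverseˡ (value A))

modus-ponens : (A B : Formula) → value (A ⇒ B) ≡ true → value A ≡ true → value B ≡ true
modus-ponens A B A⇒B A-true rewrite A-true = A⇒B

soundness : {A : Formula} → ⊢ A → value A ≡ true
soundness (taut {A} taut-A)            = tautology-true A taut-A
soundness (Q1 {x} {t} {A} {B} _ e)     = equal-implication (∀' x A) B (value-subst x t A e)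
soundness (Q2 {x} {A} {B} _)           = equal-implication (∀' x (A ⇒ B)) (A ⇒ ∀' x B) refl
soundness (Q3 {x} {t} {A} {B} _ e)     = equal-implication B (∃' x A) (sym (value-subst x t A e))
soundness (Q4 {x} {A} {B} _)           = equal-implication (∀' x (A ⇒ B)) (∃' x A ⇒ B) refl
soundness jK                           = refl
soundness jT                           = refl
soundness j4                           = refl
soundness sumL                         = refl
soundness sumR                         = refl
soundness ax-δ                         = refl
soundness (mp {A} {B} ⊢A⇒B ⊢A)         = modus-ponens A B (soundness ⊢A⇒B) (soundness ⊢A)
soundness (gen ⊢A)                     = soundness ⊢A

theorem24 : Consistent
theorem24 ⊢⊥ with soundness ⊢⊥
... | ()
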